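{- Let $P=(X,\prec)$ be a finite poset, let $z_1,z_2,z_3\in X$ be distinct, and for integers $a,b$ (not necessarily positive) let $\mathrm{F}(a,b)$ be the number of linear extensions $L$ of $P$ with $L(z_2)-L(z_1)=a$ and $L(z_3)-L(z_2)=b$, and $\mathrm{F}'(a,b)$ the number of linear extensions $L$ with $L(z_1)-L(z_2)=a$ and $L(z_3)-L(z_1)=b$. Suppose that $\mathrm{F}'(a,b)\,\mathrm{F}'(p,q)\le \mathrm{F}'(p,b)\,\mathrm{F}'(a,q)$ for all integers $a\le p$ and $b\le q$. Then for all integers $k,\ell\ge 1$, $$\mathrm{F}(k,\ell+2)\,\mathrm{F}(k+1,\ell)\ \le\ \mathrm{F}(k,\ell+1)\,\mathrm{F}(k+1,\ell+1).$$ In particular, if for every finite poset and every triple of distinct elements the inequality $\mathrm{F}(k,\ell)\mathrm{F}(p,q)\le \mathrm{F}(p,\ell)\mathrm{F}(k,q)$ holds for all integers $k\le p$, $\ell\le q$, then the displayed inequality holds for every finite poset, every triple of distinct elements and all $k,\ell\ge1$.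
   Context: A linear extension of a finite poset $P=(X,\prec)$ with $|X|=n$ is a bijection $L:X\to\{1,\dots,n\}$ with $L(u)<L(v)$ whenever $u\prec v$. -}

module Defs where

open import Data.Nat using (ℕ; zero; suc; _<_) renaming (_<?_ to _<ℕ?_)
open import Data.Fin using (Fin; toℕ)
open import Data.Fin.Properties using (all?) renaming (_≟_ to _≟ᶠ_)
open import Data.Integer as ℤ using (ℤ; +_; _-_)
open import Data.List using (List; []; _∷_; concatMap; map; length; filter; allFin)
open import Data.Product using (_×_)
open import Data.Vec.Functional using () renaming (_∷_ to _∷ᶠ_)
open import Relation.Binary.Core using (Rel)
open import Relation.Binary.Structures using (IsDecStrictPartialOrder)
open import Relation.Binary.PropositionalEquality using (_≡_)
open import Relation.Nullary using (Dec; yes; no; _→-dec_; _×-dec_)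
open import Level using (0ℓ)

record FinPoset (n : ℕ) : Set₁ where
  field
    _≺_ : Rel (Fin n) 0ℓ
    isDecSPO : IsDecStrictPartialOrder _≡_ _≺_
  open IsDecStrictPartialOrder isDecSPO public using (_<?_)

-- Enumeration of all functions Fin n → Fin m (each exactly once).
allFuns : (n m : ℕ) → List (Fin n → Fin m)
allFuns zero    m = (λ ()) ∷ []
allFuns (suc n) m = concatMap (λ f → map (λ x → x ∷ᶠ f) (allFin m)) (allFuns n m)

module _ {n : ℕ} (P : FinPoset n) where
  open FinPoset P

  -- L is a linear extension: a bijection Fin n → Fin n (positions 0..n-1,
  -- a shift of 1..n, which does not affect differences) that is injective
  -- (hence bijective on a finite set) and order preserving.
  IsLinExt : (Fin n → Fin n) → Set
  IsLinExt L = (∀ u v → L u ≡ L v → u ≡ v) × (∀ u v → u ≺ v → toℕ (L u) < toℕ (L v))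

  isLinExt? : (L : Fin n → Fin n) → Dec (IsLinExt L)
  isLinExt? L =
    all? (λ u → all? (λ v → (L u ≟ᶠ L v) →-dec (u ≟ᶠ v)))
    ×-dec all? (λ u → all? (λ v → (u <? v) →-dec (toℕ (L u) <ℕ? toℕ (L v))))

  pos : (Fin n → Fin n) → Fin n → ℤ
  pos L x = + toℕ (L x)

  CondF : (z₁ z₂ z₃ : Fin n) (a b : ℤ) → (Fin n → Fin n) → Set
  CondF z₁ z₂ z₃ a b L = IsLinExt L × (pos L z₂ - pos L z₁ ≡ a) × (pos L z₃ - pos L z₂ ≡ b)

  CondF' : (z₁ z₂ z₃ : Fin n) (a b : ℤ) → (Fin n → Fin n) → Set
  CondF' z₁ z₂ z₃ a b L = IsLinExt L × (pos L z₁ - pos L z₂ ≡ a) × (pos L z₃ - pos L z₁ ≡ b)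

  F : (z₁ z₂ z₃ : Fin n) (a b : ℤ) → ℕ
  F z₁ z₂ z₃ a b = length (filter {P = CondF z₁ z₂ z₃ a b} (λ L → isLinExt? L ×-dec (pos L z₂ - pos L z₁ ℤ.≟ a) ×-dec (pos L z₃ - pos L z₂ ℤ.≟ b)) (allFuns n n))

  F' : (z₁ z₂ z₃ : Fin n) (a b : ℤ) → ℕ
  F' z₁ z₂ z₃ a b = length (filter {P = CondF' z₁ z₂ z₃ a b} (λ L → isLinExt? L ×-dec (pos L z₁ - pos L z₂ ℤ.≟ a) ×-dec (pos L z₃ - pos L z₁ ℤ.≟ b)) (allFuns n n))

{-# OPTIONS --safe #-}
-- F and F' count the same linear extensions in sheared coordinates:
-- F(x, y) = F'(−x, x + y).  Under this change of variables the displayed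
-- inequality is the cross inequality for F' at a = −(k+1) ≤ p = −k and
-- b = k+ℓ+1 ≤ q = k+ℓ+2.
-- For the second part, F' for (z₁, z₂, z₃) is literally F for (z₂, z₁, z₃).
module Submission where

open import Defs
open import Data.Nat using (ℕ; _*_; _≤_)
open import Data.Fin using (Fin)
open import Data.Integer using (ℤ; +_) renaming (_≤_ to _≤ℤ_; _+_ to _+ℤ_)
open import Data.Product using (_×_)
open import Relation.Binary.PropositionalEquality using (_≢_)

open import Data.Integer using (-_; _-_; +≤+)
open import Data.Integer.Properties using (+-comm; neg-involutive; neg-mono-≤; i≤i+j; +-monoʳ-≤)
open import Data.Integer.Tactic.RingSolver using (solve-∀)
open import Data.List using (length; filter)
open import Data.List.Properties using (filter-≐)
open import Data.Nat using (s≤s; z≤n)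
open import Data.Nat.Properties using (module ≤-Reasoning) renaming (*-comm to *-commℕ)
open import Data.Product using (_,_)
open import Relation.Binary.PropositionalEquality using (_≡_; sym; trans; cong; cong₂)

CrossInequality : (ℤ → ℤ → ℕ) → Set
CrossInequality f =
  ∀ (a b p q : ℤ) → a ≤ℤ p → b ≤ℤ q → f a b * f p q ≤ f p b * f a q

shear-step : (f g : ℤ → ℤ → ℕ) → CrossInequality f →
  (∀ x y → g x y ≡ f (- x) (x +ℤ y)) →
  ∀ k ℓ → g k (ℓ +ℤ + 2) * g (k +ℤ + 1) ℓ ≤ g k (ℓ +ℤ + 1) * g (k +ℤ + 1) (ℓ +ℤ + 1)
shear-step f g cross g≡f k ℓ = begin
  g k (ℓ +ℤ + 2) * g (k +ℤ + 1) ℓ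
    ≡⟨ cong₂ _*_ (g≡f k (ℓ +ℤ + 2)) (trans (g≡f (k +ℤ + 1) ℓ) (cong (f _) (reassoc₁ k ℓ))) ⟩
  f p q * f a b
    ≡⟨ *-commℕ (f p q) (f a b) ⟩
  f a b * f p q
    ≤⟨ cross a b p q (neg-mono-≤ (i≤i+j k (+ 1))) (+-monoʳ-≤ k (+-monoʳ-≤ ℓ (+≤+ (s≤s z≤n)))) ⟩
  f p b * f a q
    ≡⟨ sym (cong₂ _*_ (g≡f k (ℓ +ℤ + 1)) (trans (g≡f (k +ℤ + 1) (ℓ +ℤ + 1)) (cong (f _) (reassoc₂ k ℓ)))) ⟩
  g k (ℓ +ℤ + 1) * g (k +ℤ + 1) (ℓ +ℤ + 1) ∎
  where
  open ≤-Reasoning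
  a b p q : ℤ
  a = - (k +ℤ + 1)
  b = k +ℤ (ℓ +ℤ + 1)
  p = - k
  q = k +ℤ (ℓ +ℤ + 2)
  reassoc₁ : ∀ k ℓ → (k +ℤ + 1) +ℤ ℓ ≡ k +ℤ (ℓ +ℤ + 1)
  reassoc₁ = solve-∀
  reassoc₂ : ∀ k ℓ → (k +ℤ + 1) +ℤ (ℓ +ℤ + 1) ≡ k +ℤ (ℓ +ℤ + 2)
  reassoc₂ = solve-∀

private
  minus-antisym : ∀ u v → u - v ≡ - (v - u)
  minus-antisym = solve-∀

  minus-telescope : ∀ u v w → w - u ≡ (w - v) +ℤ (v - u)
  minus-telescope = solve-∀

  +-neg-cancelˡ : ∀ x y → (x +ℤ y) +ℤ (- x) ≡ y
  +-neg-cancelˡ = solve-∀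

module _ {n : ℕ} (P : FinPoset n) (z₁ z₂ z₃ : Fin n) where

  CondF⇒CondF' : ∀ {x y L} → CondF P z₁ z₂ z₃ x y L → CondF' P z₁ z₂ z₃ (- x) (x +ℤ y) L
  CondF⇒CondF' {x} {y} {L} (linExt , e₂₁ , e₃₂) =
    linExt ,
    trans (minus-antisym (pos P L z₁) (pos P L z₂)) (cong -_ e₂₁) ,
    trans (minus-telescope (pos P L z₁) (pos P L z₂) (pos P L z₃))
          (trans (cong₂ _+ℤ_ e₃₂ e₂₁) (+-comm y x))

  CondF'⇒CondF : ∀ {x y L} → CondF' P z₁ z₂ z₃ (- x) (x +ℤ y) L → CondF P z₁ z₂ z₃ x y L
  CondF'⇒CondF {x} {y} {L} (linExt , e₁₂ , e₃₁) =
    linExt ,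
    trans (minus-antisym (pos P L z₂) (pos P L z₁)) (trans (cong -_ e₁₂) (neg-involutive x)) ,
    trans (minus-telescope (pos P L z₂) (pos P L z₁) (pos P L z₃))
          (trans (cong₂ _+ℤ_ e₃₁ e₁₂) (+-neg-cancelˡ x y))

  F≡F'-sheared : ∀ x y → F P z₁ z₂ z₃ x y ≡ F' P z₁ z₂ z₃ (- x) (x +ℤ y)
  F≡F'-sheared x y =
    cong length (filter-≐ _ _ (CondF⇒CondF' , CondF'⇒CondF) (allFuns n n))

  F-exchange-from-F'-cross : CrossInequality (F' P z₁ z₂ z₃) → ∀ k ℓ →
    F P z₁ z₂ z₃ k (ℓ +ℤ + 2) * F P z₁ z₂ z₃ (k +ℤ + 1) ℓ
      ≤ F P z₁ z₂ z₃ k (ℓ +ℤ + 1) * F P z₁ z₂ z₃ (k +ℤ + 1) (ℓ +ℤ + 1)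
  F-exchange-from-F'-cross cross =
    shear-step (F' P z₁ z₂ z₃) (F P z₁ z₂ z₃) cross F≡F'-sheared

proposition7p2 : ((n : ℕ) (P : FinPoset n) (z₁ z₂ z₃ : Fin n) →
    z₁ ≢ z₂ → z₂ ≢ z₃ → z₁ ≢ z₃ →
    (∀ (a b p q : ℤ) → a ≤ℤ p → b ≤ℤ q →
    F' P z₁ z₂ z₃ a b * F' P z₁ z₂ z₃ p q ≤ F' P z₁ z₂ z₃ p b * F' P z₁ z₂ z₃ a q) →
    ∀ (k ℓ : ℤ) → + 1 ≤ℤ k → + 1 ≤ℤ ℓ →
    F P z₁ z₂ z₃ k (ℓ +ℤ + 2) * F P z₁ z₂ z₃ (k +ℤ + 1) ℓ
    ≤ F P z₁ z₂ z₃ k (ℓ +ℤ + 1) * F P z₁ z₂ z₃ (k +ℤ + 1) (ℓ +ℤ + 1))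
    ×
    (((n : ℕ) (P : FinPoset n) (z₁ z₂ z₃ : Fin n) →
    z₁ ≢ z₂ → z₂ ≢ z₃ → z₁ ≢ z₃ →
    ∀ (k ℓ p q : ℤ) → k ≤ℤ p → ℓ ≤ℤ q →
    F P z₁ z₂ z₃ k ℓ * F P z₁ z₂ z₃ p q ≤ F P z₁ z₂ z₃ p ℓ * F P z₁ z₂ z₃ k q) →
    (n : ℕ) (P : FinPoset n) (z₁ z₂ z₃ : Fin n) →
    z₁ ≢ z₂ → z₂ ≢ z₃ → z₁ ≢ z₃ →
    ∀ (k ℓ : ℤ) → + 1 ≤ℤ k → + 1 ≤ℤ ℓ →
    F P z₁ z₂ z₃ k (ℓ +ℤ + 2) * F P z₁ z₂ z₃ (k +ℤ + 1) ℓ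
    ≤ F P z₁ z₂ z₃ k (ℓ +ℤ + 1) * F P z₁ z₂ z₃ (k +ℤ + 1) (ℓ +ℤ + 1))
proposition7p2 =
  (λ n P z₁ z₂ z₃ _ _ _ cross k ℓ _ _ → F-exchange-from-F'-cross P z₁ z₂ z₃ cross k ℓ) ,
  (λ crossF n P z₁ z₂ z₃ z₁≢z₂ z₂≢z₃ z₁≢z₃ k ℓ _ _ →
    F-exchange-from-F'-cross P z₁ z₂ z₃
      (crossF n P z₂ z₁ z₃ (λ e → z₁≢z₂ (sym e)) z₁≢z₃ z₂≢z₃) k ℓ)
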